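{- Let $\mathcal{G}$ be a finite simple undirected graph and let $u$, $u'$ be distinct vertices of $\mathcal{G}$ with $\mathcal{N}(u)=\mathcal{N}(u')$ (proper F-twin vertices). Suppose $u$ is properly contained in a connected induced subgraph $H$ of $\mathcal{G}$ (i.e., $u\in V(H)$ and $H$ has at least one other vertex) which is a proper F-twin. Then $u'$ also belongs to $H$.
   Context: All graphs are finite, undirected, without loops or parallel edges. For a vertex $u$, $\mathcal{N}(u)$ denotes the set of vertices adjacent to $u$. Two induced subgraphs $H_1,H_2$ of $\mathcal{G}$ with vertex sets $V_1,V_2$ are called F-twins if there is a graph isomorphism $\varphi:V_1\to V_2$ between $H_1$ and $H_2$ such that $\mathcal{N}(u)-V_1=\mathcal{N}(\varphi(u))-V_2$ for all $u\in V_1$. An induced subgraph is a proper F-twin if it has an F-twin different from itself. For single vertices, being F-twins amounts to $\mathcal{N}(u)=\mathcal{N}(v)$. -}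

module Defs where

open import Data.Nat using (ℕ)
open import Data.Fin using (Fin)
open import Data.Bool using (Bool; true; false; T; not; _∧_)
open import Data.Product using (Σ; _×_; ∃; proj₁)
open import Relation.Binary.PropositionalEquality using (_≡_)
open import Relation.Nullary using (¬_)
open import Function.Bundles using (_↔_; Inverse)

record Graph (n : ℕ) : Set where
  field
    adj     : Fin n → Fin n → Bool
    sym     : ∀ x y → adj x y ≡ adj y x
    irrefl  : ∀ x → adj x x ≡ false
open Graph public

-- A vertex set (determining an induced subgraph), as a Boolean predicate.
VSet : ℕ → Set
VSet n = Fin n → Bool

Elem : ∀ {n} → VSet n → Set
Elem {n} V = Σ (Fin n) (λ v → T (V v))

data Walk {n} (G : Graph n) (V : VSet n) : Fin n → Fin n → Set where
  here : ∀ {x} → T (V x) → Walk G V x x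
  step : ∀ {x y z} → T (V x) → T (adj G x y) → Walk G V y z → Walk G V x z

Connected : ∀ {n} → Graph n → VSet n → Set
Connected G V = ∀ x y → T (V x) → T (V y) → Walk G V x y

SameVSet : ∀ {n} → VSet n → VSet n → Set
SameVSet V₁ V₂ = ∀ v → V₁ v ≡ V₂ v

-- φ : V₁ → V₂ is an isomorphism G[V₁] ≅ G[V₂] with N(u) - V₁ = N(φ u) - V₂.
record FTwinIso {n} (G : Graph n) (V₁ V₂ : VSet n) : Set where
  field
    φ        : Elem V₁ ↔ Elem V₂
    adj-pres : ∀ (a b : Elem V₁) →
               adj G (proj₁ a) (proj₁ b) ≡
               adj G (proj₁ (Inverse.to φ a)) (proj₁ (Inverse.to φ b))
    ext-nbhd : ∀ (a : Elem V₁) (w : Fin n) →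
               (not (V₁ w) ∧ adj G (proj₁ a) w) ≡
               (not (V₂ w) ∧ adj G (proj₁ (Inverse.to φ a)) w)

FTwins : ∀ {n} → Graph n → VSet n → VSet n → Set
FTwins G V₁ V₂ = FTwinIso G V₁ V₂

ProperFTwin : ∀ {n} → Graph n → VSet n → Set
ProperFTwin {n} G V = Σ (VSet n) (λ V₂ → FTwins G V V₂ × ¬ SameVSet V V₂)

SameNbhd : ∀ {n} → Graph n → Fin n → Fin n → Set
SameNbhd {n} G u u' = ∀ (w : Fin n) → adj G u w ≡ adj G u' w

-- Suppose u' ∉ H and let H₂ be an F-twin of H via φ, H₂ ≠ H. Since H is connected
-- and not just u, u has a neighbour a in H. Then u' is a neighbour of a outside H,
-- so by the F-twin condition it is a neighbour of φ(a) outside H₂; as N(u) = N(u'),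
-- φ(a) is adjacent to u, and the F-twin condition read backwards puts u in H₂.
-- Finally, two connected F-twins sharing a vertex coincide: a neighbour of V₁
-- outside V₁ also lies outside V₂, so no walk inside V₂ can leave V₁, and vice versa.
module Submission where

open import Defs hiding (sym)
open import Data.Nat using (ℕ)
open import Data.Fin using (Fin)
open import Data.Bool using (true; false; T; not; _∧_; T?)
open import Data.Bool.Properties using (T-irrelevant)
open import Data.Empty using (⊥-elim)
open import Data.Product using (Σ; _×_; _,_; proj₁; proj₂)
open import Function.Bundles using (Inverse)
open import Function.Properties.Inverse using (↔-sym)
open import Relation.Binary.PropositionalEquality
  using (_≡_; refl; sym; trans; cong; cong₂; subst; subst₂)
open import Relation.Nullary using (¬_)
open import Relation.Nullary.Decidable using (decidable-stable)

T-injective : ∀ {x y} → (T x → T y) → (T y → T x) → x ≡ y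
T-injective {false} {false} _ _ = refl
T-injective {false} {true}  _ y⇒x = ⊥-elim (y⇒x _)
T-injective {true}  {false} x⇒y _ = ⊥-elim (x⇒y _)
T-injective {true}  {true}  _ _ = refl

∉∧adj-transfer : ∀ {p q p' q'} → (not p ∧ q) ≡ (not p' ∧ q') →
                 ¬ T p → T q → ¬ T p' × T q'
∉∧adj-transfer {true}                           _  p∉ _ = ⊥-elim (p∉ _)
∉∧adj-transfer {false} {true} {false} {true}  refl _  _ = (λ ()) , _
∉∧adj-transfer {false} {true} {false} {false} ()
∉∧adj-transfer {false} {true} {true}          ()

module _ {n : ℕ} {G : Graph n} where

  adj-sym : ∀ {x y} → T (adj G x y) → T (adj G y x)
  adj-sym {x} {y} = subst T (Graph.sym G x y)

  walk-source : ∀ {V : VSet n} {x y} → Walk G V x y → T (V x)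
  walk-source (here x∈)     = x∈
  walk-source (step x∈ _ _) = x∈

  neighbour-in-connected : ∀ {H : VSet n} {u w} → Connected G H → T (H u) → T (H w) →
                           ¬ w ≡ u → Σ (Elem H) (λ a → T (adj G u (proj₁ a)))
  neighbour-in-connected {u = u} {w} conn u∈ w∈ = first-step (conn u w u∈ w∈)
    where
    first-step : ∀ {z} → Walk G _ u z → ¬ z ≡ u → Σ (Elem _) (λ a → T (adj G u (proj₁ a)))
    first-step (here _)            z≢u = ⊥-elim (z≢u refl)
    first-step (step _ u~y rest) _   = (_ , walk-source rest) , u~y

  module _ {V₁ V₂ : VSet n} (iso : FTwins G V₁ V₂) where
    open FTwinIso iso

    private
      to   = Inverse.to φ
      from = Inverse.from φ

      to∘from : ∀ b → to (from b) ≡ b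
      to∘from = Inverse.strictlyInverseˡ φ

    outer-neighbour : ∀ (a : Elem V₁) {w} → ¬ T (V₁ w) → T (adj G (proj₁ a) w) →
                      ¬ T (V₂ w) × T (adj G (proj₁ (to a)) w)
    outer-neighbour a {w} = ∉∧adj-transfer (ext-nbhd a w)

    outer-neighbour⁻ : ∀ (a : Elem V₁) {w} → ¬ T (V₂ w) → T (adj G (proj₁ (to a)) w) →
                       ¬ T (V₁ w) × T (adj G (proj₁ a) w)
    outer-neighbour⁻ a {w} = ∉∧adj-transfer (sym (ext-nbhd a w))

    FTwins-sym : FTwins G V₂ V₁
    FTwins-sym = record
      { φ        = ↔-sym φ
      ; adj-pres = λ a b → sym (trans (adj-pres (from a) (from b))
                                      (cong₂ (λ c d → adj G (proj₁ c) (proj₁ d)) (to∘from a) (to∘from b)))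
      ; ext-nbhd = λ a w → sym (trans (ext-nbhd (from a) w)
                                      (cong (λ c → not (V₂ w) ∧ adj G (proj₁ c) w) (to∘from a)))
      }

    walk-stays : ∀ {x y} → Walk G V₂ x y → T (V₁ x) → T (V₁ y)
    walk-stays (here _)                     x∈ = x∈
    walk-stays (step {y = y} _ x~y rest) x∈ = walk-stays rest y∈
      where
      y∈ : T (V₁ y)
      y∈ = decidable-stable (T? (V₁ y)) λ y∉ →
             proj₁ (outer-neighbour (_ , x∈) y∉ x~y) (walk-source rest)

    map-walk : ∀ {x y} → Walk G V₁ x y → (x∈ : T (V₁ x)) (y∈ : T (V₁ y)) →
               Walk G V₂ (proj₁ (to (x , x∈))) (proj₁ (to (y , y∈)))
    map-walk (here _) x∈ y∈ rewrite T-irrelevant x∈ y∈ = here (proj₂ (to (_ , y∈)))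
    map-walk (step {y = y} _ x~y rest) x∈ z∈ =
      step (proj₂ (to (_ , x∈)))
           (subst T (adj-pres (_ , x∈) (y , walk-source rest)) x~y)
           (map-walk rest (walk-source rest) z∈)

    connected-twin : Connected G V₁ → Connected G V₂
    connected-twin conn x y x∈ y∈ =
      subst₂ (Walk G V₂) (cong proj₁ (to∘from (x , x∈))) (cong proj₁ (to∘from (y , y∈)))
             (map-walk (conn _ _ x'∈ y'∈) x'∈ y'∈)
      where
      x'∈ = proj₂ (from (x , x∈))
      y'∈ = proj₂ (from (y , y∈))

  connected-FTwins-meeting-same : ∀ {V₁ V₂ : VSet n} {x} → FTwins G V₁ V₂ → Connected G V₁ →
                                  T (V₁ x) → T (V₂ x) → SameVSet V₁ V₂
  connected-FTwins-meeting-same {V₁} {V₂} {x} iso conn x∈₁ x∈₂ v = T-injective V₁⊆V₂ V₂⊆V₁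
    where
    V₁⊆V₂ : T (V₁ v) → T (V₂ v)
    V₁⊆V₂ v∈ = walk-stays (FTwins-sym iso) (conn x v x∈₁ v∈) x∈₂

    V₂⊆V₁ : T (V₂ v) → T (V₁ v)
    V₂⊆V₁ v∈ = walk-stays iso (connected-twin iso conn x v x∈₂ v∈) x∈₁

  twin-of-outside-∈-FTwin : ∀ {H V₂ : VSet n} {u u'} → FTwins G H V₂ → SameNbhd G u u' →
                            T (H u) → ¬ T (H u') → (a : Elem H) → T (adj G u (proj₁ a)) →
                            T (V₂ u)
  twin-of-outside-∈-FTwin {V₂ = V₂} {u} iso same-nbhd u∈ u'∉ a u~a =
    decidable-stable (T? (V₂ u)) λ u∉ → proj₁ (outer-neighbour⁻ iso a u∉ φa~u) u∈
    where
    φa = proj₁ (Inverse.to (FTwinIso.φ iso) a)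

    φa~u' : T (adj G φa _)
    φa~u' = proj₂ (outer-neighbour iso a u'∉ (adj-sym (subst T (same-nbhd (proj₁ a)) u~a)))

    φa~u : T (adj G φa u)
    φa~u = adj-sym (subst T (sym (same-nbhd φa)) (adj-sym φa~u'))

proposition5 : ∀ {n} (G : Graph n) (u u' : Fin n) → ¬ u ≡ u' → SameNbhd G u u' →
               (H : VSet n) → Connected G H → T (H u) →
               Σ (Fin n) (λ w → ¬ w ≡ u × T (H w)) → ProperFTwin G H →
               T (H u')
proposition5 G u u' _ same-nbhd H conn u∈H (w , w≢u , w∈H) (V₂ , iso , H≠V₂) =
  decidable-stable (T? (H u')) λ u'∉H →
    H≠V₂ (connected-FTwins-meeting-same iso conn u∈H
            (twin-of-outside-∈-FTwin iso same-nbhd u∈H u'∉H a u~a))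
  where
  neighbour = neighbour-in-connected conn u∈H w∈H w≢u
  a   = proj₁ neighbour
  u~a = proj₂ neighbour
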